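{- For integers $2\le d\le n$, $\beta^d(n) \geq \frac{2n(n-1)}{d^2}$.
   Context: Two vectors $A,B\in\mathbb{R}^n$ are trivially orthogonal if for every coordinate $i\in[n]$ at least one of $A(i)$, $B(i)$ is zero; they are non-trivially orthogonal if they are orthogonal (inner product $0$) but not trivially orthogonal. For $2\le d\le n$, the trivial points of $\{0,1\}^n$ are the all-zero vector and the $n$ unit vectors, together with the all-ones vector when $d$ is odd. $\beta^d(n)$ is the minimum cardinality of a set $\mathcal{V}$ of vectors in $\{ -1,0,1\}^n$, each having exactly $d$ non-zero entries, such that every non-trivial point $A\in\{0,1\}^n$ has some $V\in\mathcal{V}$ non-trivially orthogonal to $A$. -}

module Defs where

open import Data.Nat using (ℕ; zero; suc)
open import Data.Nat.DivMod using (_%_)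
open import Data.List using (List)
open import Data.List.Relation.Unary.All using (All)
open import Data.List.Relation.Unary.Any using (Any)
open import Data.Integer as ℤ using (ℤ; 0ℤ; 1ℤ; -1ℤ)
open import Data.Bool using (Bool; true; false)
open import Data.Fin using (Fin)
open import Data.Vec using (Vec; lookup; zipWith; foldr; count)
open import Data.Product using (_×_)
open import Data.Sum using (_⊎_)
open import Relation.Binary.PropositionalEquality using (_≡_; _≢_)
open import Relation.Nullary using (¬_; Dec; ¬?)
open import Data.Integer.Properties using () renaming (_≟_ to _≟ℤ_)


-- 0/1 vectors are represented as Vec Bool n (true = 1, false = 0)
bitℤ : Bool → ℤ
bitℤ true  = 1ℤ
bitℤ false = 0ℤ

embed : ∀ {n} → Vec Bool n → Vec ℤ n
embed = Data.Vec.map bitℤ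

dot : ∀ {n} → Vec ℤ n → Vec ℤ n → ℤ
dot u v = foldr _ ℤ._+_ 0ℤ (zipWith ℤ._*_ u v)

Orthogonal : ∀ {n} → Vec ℤ n → Vec ℤ n → Set
Orthogonal u v = dot u v ≡ 0ℤ

TriviallyOrthogonal : ∀ {n} → Vec ℤ n → Vec ℤ n → Set
TriviallyOrthogonal {n} u v = (i : Fin n) → (lookup u i ≡ 0ℤ) ⊎ (lookup v i ≡ 0ℤ)

NonTriviallyOrthogonal : ∀ {n} → Vec ℤ n → Vec ℤ n → Set
NonTriviallyOrthogonal u v = Orthogonal u v × ¬ TriviallyOrthogonal u v

IsSignVector : ∀ {n} → Vec ℤ n → Set
IsSignVector {n} v = (i : Fin n) → (lookup v i ≡ -1ℤ) ⊎ (lookup v i ≡ 0ℤ) ⊎ (lookup v i ≡ 1ℤ)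

support : ∀ {n} → Vec ℤ n → ℕ
support v = count (λ x → ¬? (x ≟ℤ 0ℤ)) v

weight : ∀ {n} → Vec Bool n → ℕ
weight = count (λ b → b Data.Bool.≟ true)

Odd : ℕ → Set
Odd d = d % 2 ≡ 1

-- trivial points of {0,1}^n w.r.t. d: the all-zero vector (weight 0),
-- the unit vectors (weight 1), and the all-ones vector (weight n) when d is odd
IsTrivialPoint : (d n : ℕ) → Vec Bool n → Set
IsTrivialPoint d n A = (weight A ≡ 0) ⊎ (weight A ≡ 1) ⊎ (Odd d × weight A ≡ n)

-- 𝒱 (a list of vectors) is admissible for β^d(n)
Admissible : (d n : ℕ) → List (Vec ℤ n) → Set
Admissible d n 𝒱 =
  All (λ V → IsSignVector V × support V ≡ d) 𝒱 ×
  ((A : Vec Bool n) → ¬ IsTrivialPoint d n A →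
     Any (λ V → NonTriviallyOrthogonal V (embed A)) 𝒱)

module Submission where

-- Lower bound β^d(n) ≥ 2n(n-1)/d², by double counting ordered pairs of coordinates.
--
-- For distinct coordinates i ≠ j the point e_i + e_j ∈ {0,1}^n has weight 2, so it is not
-- trivial (weight n = 2 would force d = 2, which is even).  Hence an admissible family 𝒱
-- contains some V non-trivially orthogonal to it: V_i + V_j = 0 with V_i, V_j not both zero,
-- i.e. V_i and V_j are opposite signs; we say V separates (i , j).  Summing over all ordered
-- pairs gives  n(n-1) ≤ Σ_{V ∈ 𝒱} #{(i , j) separated by V}.
-- A vector V with p entries +1 and q entries -1 separates exactly 2pq ordered pairs, and when
-- V ∈ {-1,0,1}^n has d non-zero entries we have p + q = d, so 4pq ≤ (p + q)² = d².  Each member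
-- of 𝒱 therefore separates at most d²/2 pairs, and 2n(n-1) ≤ d² |𝒱|.

open import Defs
open import Data.Nat using (ℕ; _≤_; _*_; _∸_)
open import Data.List using (List; length)
open import Data.List.Relation.Unary.Unique.Propositional using (Unique)
open import Data.Vec using (Vec)
open import Data.Integer using (ℤ)

open import Data.Nat using (zero; suc; _+_; _<_; z≤n; s≤s)
open import Data.Nat.Properties
  using (+-*-semiring; +-mono-≤; +-suc; m≤m+n; m≤n+m; ≤-trans; ≤-total; ≤-antisym; m+[n∸m]≡n;
         +-comm; *-comm; *-assoc; *-identityʳ; *-monoʳ-≤; module ≤-Reasoning)
open import Data.Nat.Solver using (module +-*-Solver)
open import Data.Integer as ℤ using (0ℤ; 1ℤ; -1ℤ)
import Data.Integer.Properties as ℤP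
import Data.List as List
open import Data.List.Relation.Unary.All as All using (lookupAny)
open import Data.List.Membership.Propositional.Properties using (∈-lookup)
import Data.List.Relation.Unary.Any as Any
open import Data.Vec using (_∷_; []; lookup; tabulate)
open import Data.Vec.Properties using (lookup-map; lookup∘tabulate; tabulate-cong)
open import Data.Fin using (Fin; zero; suc)
open import Data.Fin.Properties using (_≟_)
open import Data.Bool using (Bool; true; false; _∨_; not)
open import Data.Bool.Properties using (∨-comm)
open import Data.Product using (_×_; _,_)
open import Data.Sum using (_⊎_; inj₁; inj₂)
open import Data.Empty using (⊥-elim)
open import Relation.Nullary using (¬_; Dec; yes; no; does)
open import Relation.Binary.PropositionalEquality
open import Function using (_∘_)
open import Algebra.Properties.Semiring.Sum +-*-semiring
  using (sum; sum-syntax; sum-cong-≗; ∑-comm; ∑-distrib-+; *-distribˡ-sum; *-distribʳ-sum)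

𝟙 : Bool → ℕ
𝟙 true  = 1
𝟙 false = 0

∑-mono-≤ : ∀ {m} {f g : Fin m → ℕ} → (∀ i → f i ≤ g i) → sum f ≤ sum g
∑-mono-≤ {zero}  f≤g = z≤n
∑-mono-≤ {suc m} f≤g = +-mono-≤ (f≤g zero) (∑-mono-≤ (f≤g ∘ suc))

term≤∑ : ∀ {m} (f : Fin m → ℕ) (i : Fin m) → f i ≤ sum f
term≤∑ f zero    = m≤m+n (f zero) _
term≤∑ f (suc i) = ≤-trans (term≤∑ (f ∘ suc) i) (m≤n+m _ (f zero))

∑-const : ∀ m c → ∑[ i < m ] c ≡ m * c
∑-const zero    c = refl
∑-const (suc m) c = cong (c +_) (∑-const m c)

∑-bound : ∀ {m} (f : Fin m → ℕ) {c : ℕ} → (∀ i → f i ≤ c) → sum f ≤ m * c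
∑-bound {m} f {c} f≤c = subst (sum f ≤_) (∑-const m c) (∑-mono-≤ f≤c)

offDiagonal : ∀ {m} → Fin m → Fin m → ℕ
offDiagonal i j = 𝟙 (not (does (i ≟ j)))

offDiagonal-row : ∀ {m} (i : Fin (suc m)) → ∑[ j < suc m ] offDiagonal i j ≡ m
offDiagonal-row {m}     zero    = trans (∑-const m 1) (*-identityʳ m)
offDiagonal-row {suc m} (suc i) = cong suc (offDiagonal-row i)

offDiagonal-count : ∀ n → ∑[ i < n ] ∑[ j < n ] offDiagonal i j ≡ n * (n ∸ 1)
offDiagonal-count zero    = refl
offDiagonal-count (suc m) = trans (sum-cong-≗ (offDiagonal-row {m})) (∑-const (suc m) m)

unit : ∀ {n} → Fin n → Vec Bool n
unit j = tabulate (λ k → does (k ≟ j))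

pair : ∀ {n} → Fin n → Fin n → Vec Bool n
pair i j = tabulate (λ k → does (k ≟ i) ∨ does (k ≟ j))

origin : ∀ n → Vec Bool n
origin n = tabulate {n = n} (λ _ → false)

-- e_i + e_j is symmetric in i and j; this reduces the case (suc i , zero) to (zero , suc i).
pair-comm : ∀ {n} (i j : Fin n) → pair i j ≡ pair j i
pair-comm i j = tabulate-cong (λ k → ∨-comm (does (k ≟ i)) (does (k ≟ j)))

pair-support : ∀ {n} (i j k : Fin n) → lookup (pair i j) k ≡ true → k ≡ i ⊎ k ≡ j
pair-support i j k eq
  rewrite lookup∘tabulate (λ k → does (k ≟ i) ∨ does (k ≟ j)) k
  with k ≟ i | k ≟ j
... | yes k≡i | _       = inj₁ k≡i
... | no _    | yes k≡j = inj₂ k≡j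

weight-origin : ∀ n → weight (origin n) ≡ 0
weight-origin zero    = refl
weight-origin (suc n) = weight-origin n

weight-unit : ∀ {n} (j : Fin n) → weight (unit j) ≡ 1
weight-unit {suc n} zero    = cong suc (weight-origin n)
weight-unit         (suc j) = weight-unit j

weight-pair : ∀ {n} {i j : Fin n} → i ≢ j → weight (pair i j) ≡ 2
weight-pair {i = zero}  {zero}  i≢j = ⊥-elim (i≢j refl)
weight-pair {i = zero}  {suc j} i≢j = cong suc (weight-unit j)
weight-pair {i = suc i} {zero}  i≢j =
  trans (cong weight (pair-comm (suc i) zero)) (weight-pair (i≢j ∘ sym))
weight-pair {i = suc i} {suc j} i≢j = weight-pair (i≢j ∘ cong suc)

dot-origin : ∀ {n} (V : Vec ℤ n) → dot V (embed (origin n)) ≡ 0ℤ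
dot-origin []      = refl
dot-origin (x ∷ V) rewrite dot-origin V | ℤP.*-zeroʳ x = refl

dot-unit : ∀ {n} (V : Vec ℤ n) (j : Fin n) → dot V (embed (unit j)) ≡ lookup V j
dot-unit (x ∷ V) zero    rewrite dot-origin V | ℤP.*-identityʳ x = ℤP.+-identityʳ x
dot-unit (x ∷ V) (suc j) rewrite dot-unit V j | ℤP.*-zeroʳ x = ℤP.+-identityˡ (lookup V j)

dot-pair : ∀ {n} (V : Vec ℤ n) {i j : Fin n} → i ≢ j →
           dot V (embed (pair i j)) ≡ lookup V i ℤ.+ lookup V j
dot-pair (x ∷ V) {zero}  {zero}  i≢j = ⊥-elim (i≢j refl)
dot-pair (x ∷ V) {zero}  {suc j} i≢j rewrite dot-unit V j | ℤP.*-identityʳ x = refl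
dot-pair (x ∷ V) {suc i} {zero}  i≢j = begin
  dot (x ∷ V) (embed (pair (suc i) zero)) ≡⟨ cong (dot (x ∷ V) ∘ embed) (pair-comm (suc i) zero) ⟩
  dot (x ∷ V) (embed (pair zero (suc i))) ≡⟨ dot-pair (x ∷ V) (i≢j ∘ sym) ⟩
  x ℤ.+ lookup V i                        ≡⟨ ℤP.+-comm x (lookup V i) ⟩
  lookup V i ℤ.+ x                        ∎
  where open ≡-Reasoning
dot-pair (x ∷ V) {suc i} {suc j} i≢j
  rewrite dot-pair V (i≢j ∘ cong suc) | ℤP.*-zeroʳ x = ℤP.+-identityˡ _

pair-nonTrivial : ∀ {d n} {i j : Fin n} → 2 ≤ d → d ≤ n → i ≢ j → ¬ IsTrivialPoint d n (pair i j)
pair-nonTrivial {d} {n} 2≤d d≤n i≢j trivial rewrite weight-pair i≢j = weight2 trivial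
  where
  -- only the all-ones case needs an argument: 2 = n ≥ d ≥ 2 makes d = 2, which is even
  weight2 : ¬ ((2 ≡ 0) ⊎ (2 ≡ 1) ⊎ (Odd d × 2 ≡ n))
  weight2 (inj₂ (inj₂ (odd , refl))) with ≤-antisym d≤n 2≤d
  weight2 (inj₂ (inj₂ (()  , refl))) | refl

vanishing⇒trivial : ∀ {n} (V : Vec ℤ n) (A : Vec Bool n) →
                    (∀ k → lookup A k ≡ true → lookup V k ≡ 0ℤ) →
                    TriviallyOrthogonal V (embed A)
vanishing⇒trivial V A vanishes k rewrite lookup-map k bitℤ A with lookup A k in Aₖ
... | true  = inj₁ (vanishes k Aₖ)
... | false = inj₂ refl

SignEntry : ℤ → Set
SignEntry a = (a ≡ -1ℤ) ⊎ (a ≡ 0ℤ) ⊎ (a ≡ 1ℤ)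

isPlusOne : ℤ → ℕ
isPlusOne (ℤ.+ 1) = 1
isPlusOne _       = 0

isMinusOne : ℤ → ℕ
isMinusOne ℤ.-[1+ 0 ] = 1
isMinusOne _          = 0

opposite : ℤ → ℤ → ℕ
opposite a b = isPlusOne a * isMinusOne b + isMinusOne a * isPlusOne b

cancelling⇒opposite : ∀ {a b} → SignEntry a → SignEntry b →
                      a ℤ.+ b ≡ 0ℤ → ¬ (a ≡ 0ℤ × b ≡ 0ℤ) → 0 < opposite a b
cancelling⇒opposite (inj₁ refl)        (inj₂ (inj₂ refl)) _ _ = s≤s z≤n
cancelling⇒opposite (inj₂ (inj₂ refl)) (inj₁ refl)        _ _ = s≤s z≤n
cancelling⇒opposite (inj₂ (inj₁ refl)) (inj₂ (inj₁ refl)) _ both0 = ⊥-elim (both0 (refl , refl))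
cancelling⇒opposite (inj₁ refl)        (inj₁ refl)        () _
cancelling⇒opposite (inj₁ refl)        (inj₂ (inj₁ refl)) () _
cancelling⇒opposite (inj₂ (inj₁ refl)) (inj₁ refl)        () _
cancelling⇒opposite (inj₂ (inj₁ refl)) (inj₂ (inj₂ refl)) () _
cancelling⇒opposite (inj₂ (inj₂ refl)) (inj₂ (inj₁ refl)) () _
cancelling⇒opposite (inj₂ (inj₂ refl)) (inj₂ (inj₂ refl)) () _

nonTrivial⇒opposite : ∀ {n} (V : Vec ℤ n) {i j : Fin n} → IsSignVector V → i ≢ j →
                      NonTriviallyOrthogonal V (embed (pair i j)) →
                      0 < opposite (lookup V i) (lookup V j)
nonTrivial⇒opposite V {i} {j} sign i≢j (orthogonal , nonTrivial) =
  cancelling⇒opposite (sign i) (sign j) (trans (sym (dot-pair V i≢j)) orthogonal) bothZero⇒trivial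
  where
  bothZero⇒trivial : ¬ (lookup V i ≡ 0ℤ × lookup V j ≡ 0ℤ)
  bothZero⇒trivial (Vᵢ≡0 , Vⱼ≡0) = nonTrivial (vanishing⇒trivial V (pair i j) vanishes)
    where
    vanishes : ∀ k → lookup (pair i j) k ≡ true → lookup V k ≡ 0ℤ
    vanishes k eq with pair-support i j k eq
    ... | inj₁ refl = Vᵢ≡0
    ... | inj₂ refl = Vⱼ≡0

plusCount minusCount : ∀ {n} → Vec ℤ n → ℕ
plusCount  {n} V = ∑[ i < n ] isPlusOne (lookup V i)
minusCount {n} V = ∑[ i < n ] isMinusOne (lookup V i)

separatedPairs : ∀ {n} → Vec ℤ n → ℕ
separatedPairs {n} V = ∑[ i < n ] ∑[ j < n ] opposite (lookup V i) (lookup V j)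

separatedPairs-count : ∀ {n} (V : Vec ℤ n) →
                       separatedPairs V ≡ plusCount V * minusCount V + minusCount V * plusCount V
separatedPairs-count {n} V = begin
  ∑[ i < n ] ∑[ j < n ] (P i * M j + M i * P j)  ≡⟨ sum-cong-≗ row ⟩
  ∑[ i < n ] (P i * q + M i * p)                 ≡⟨ ∑-distrib-+ (λ i → P i * q) (λ i → M i * p) ⟩
  ∑[ i < n ] (P i * q) + ∑[ i < n ] (M i * p)    ≡⟨ cong₂ _+_ (sym (*-distribʳ-sum q P))
                                                                 (sym (*-distribʳ-sum p M)) ⟩
  p * q + q * p                                  ∎
  where
  open ≡-Reasoning
  P M : Fin n → ℕ
  P i = isPlusOne (lookup V i)
  M i = isMinusOne (lookup V i)
  p = plusCount V
  q = minusCount V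
  row : ∀ i → ∑[ j < n ] (P i * M j + M i * P j) ≡ P i * q + M i * p
  row i = trans (∑-distrib-+ (λ j → P i * M j) (λ j → M i * P j))
                (sym (cong₂ _+_ (*-distribˡ-sum (P i) M) (*-distribˡ-sum (M i) P)))

support-sign : ∀ {n} (V : Vec ℤ n) → IsSignVector V → support V ≡ plusCount V + minusCount V
support-sign []      sign = refl
support-sign (x ∷ V) sign with sign zero | support-sign V (sign ∘ suc)
... | inj₁ refl        | eq = trans (cong suc eq) (sym (+-suc _ _))
... | inj₂ (inj₁ refl) | eq = eq
... | inj₂ (inj₂ refl) | eq = cong suc eq

-- AM-GM for natural numbers: 4pq ≤ (p + q)², since (p + q)² = 4pq + (q - p)².
amgm-ordered : ∀ {p q} → p ≤ q → 2 * (p * q + q * p) ≤ (p + q) * (p + q)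
amgm-ordered {p} {q} p≤q =
  subst (λ q → 2 * (p * q + q * p) ≤ (p + q) * (p + q)) (m+[n∸m]≡n p≤q) (gap p (q ∸ p))
  where
  open +-*-Solver
  square-expansion : ∀ p r → (p + (p + r)) * (p + (p + r)) ≡ 2 * (p * (p + r) + (p + r) * p) + r * r
  square-expansion = solve 2 (λ p r → (p :+ (p :+ r)) :* (p :+ (p :+ r))
                                   := con 2 :* (p :* (p :+ r) :+ (p :+ r) :* p) :+ r :* r) refl
  gap : ∀ p r → 2 * (p * (p + r) + (p + r) * p) ≤ (p + (p + r)) * (p + (p + r))
  gap p r = subst (2 * (p * (p + r) + (p + r) * p) ≤_) (sym (square-expansion p r)) (m≤m+n _ (r * r))

amgm : ∀ p q → 2 * (p * q + q * p) ≤ (p + q) * (p + q)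
amgm p q with ≤-total p q
... | inj₁ p≤q = amgm-ordered p≤q
... | inj₂ q≤p = subst₂ _≤_ (cong (2 *_) (+-comm (q * p) (p * q)))
                            (cong₂ _*_ (+-comm q p) (+-comm q p)) (amgm-ordered q≤p)

separatedPairs-bound : ∀ {n d} (V : Vec ℤ n) → IsSignVector V → support V ≡ d →
                       2 * separatedPairs V ≤ d * d
separatedPairs-bound V sign refl rewrite separatedPairs-count V | support-sign V sign =
  amgm (plusCount V) (minusCount V)

member : ∀ {n} (𝒱 : List (Vec ℤ n)) → Fin (length 𝒱) → Vec ℤ n
member = List.lookup

offDiagonal-covered : ∀ {d n} {𝒱 : List (Vec ℤ n)} → 2 ≤ d → d ≤ n → Admissible d n 𝒱 →
                      (i j : Fin n) →
                      offDiagonal i j ≤ ∑[ v < length 𝒱 ] opposite (lookup (member 𝒱 v) i)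
                                                                    (lookup (member 𝒱 v) j)
offDiagonal-covered {𝒱 = 𝒱} 2≤d d≤n (members , hits) i j = covered (i ≟ j)
  where
  separation : Fin (length 𝒱) → ℕ
  separation v = opposite (lookup (member 𝒱 v) i) (lookup (member 𝒱 v) j)
  covered : (i≟j : Dec (i ≡ j)) → 𝟙 (not (does i≟j)) ≤ sum separation
  covered (yes _)  = z≤n
  covered (no i≢j) with hits (pair i j) (pair-nonTrivial 2≤d d≤n i≢j)
  ... | hit with lookupAny members hit
  ... | (sign , _) , nonTrivial =
    ≤-trans (nonTrivial⇒opposite (Any.lookup hit) sign i≢j nonTrivial)
            (term≤∑ separation (Any.index hit))

pairs-separated : ∀ {d n} {𝒱 : List (Vec ℤ n)} → 2 ≤ d → d ≤ n → Admissible d n 𝒱 →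
                  n * (n ∸ 1) ≤ ∑[ v < length 𝒱 ] separatedPairs (member 𝒱 v)
pairs-separated {n = n} {𝒱} 2≤d d≤n admissible = begin
  n * (n ∸ 1)                                  ≡⟨ offDiagonal-count n ⟨
  ∑[ i < n ] ∑[ j < n ] offDiagonal i j        ≤⟨ ∑-mono-≤ (λ i → ∑-mono-≤ (λ j →
                                                    offDiagonal-covered 2≤d d≤n admissible i j)) ⟩
  ∑[ i < n ] ∑[ j < n ] ∑[ v < m ] sep v i j   ≡⟨ sum-cong-≗ (λ i → ∑-comm (λ j v → sep v i j)) ⟩
  ∑[ i < n ] ∑[ v < m ] ∑[ j < n ] sep v i j   ≡⟨ ∑-comm (λ i v → ∑[ j < n ] sep v i j) ⟩
  ∑[ v < m ] ∑[ i < n ] ∑[ j < n ] sep v i j   ∎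
  where
  open ≤-Reasoning
  m = length 𝒱
  sep : Fin m → Fin n → Fin n → ℕ
  sep v i j = opposite (lookup (member 𝒱 v) i) (lookup (member 𝒱 v) j)

-- The theorem: β^d(n) ≥ 2n(n-1)/d².  The count never uses that 𝒱 has no repetitions.

proposition1 : (d n : ℕ) → 2 ≤ d → d ≤ n →
    (𝒱 : List (Vec ℤ n)) → Unique 𝒱 → Admissible d n 𝒱 →
    2 * n * (n ∸ 1) ≤ d * d * length 𝒱
proposition1 d n 2≤d d≤n 𝒱 _ admissible@(members , _) = begin
  2 * n * (n ∸ 1)                                  ≡⟨ *-assoc 2 n (n ∸ 1) ⟩
  2 * (n * (n ∸ 1))                                ≤⟨ *-monoʳ-≤ 2 (pairs-separated 2≤d d≤n admissible) ⟩
  2 * ∑[ v < m ] separatedPairs (member 𝒱 v)       ≡⟨ *-distribˡ-sum 2 (separatedPairs ∘ member 𝒱) ⟩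
  ∑[ v < m ] (2 * separatedPairs (member 𝒱 v))     ≤⟨ ∑-bound _ memberBound ⟩
  m * (d * d)                                      ≡⟨ *-comm m (d * d) ⟩
  d * d * m                                        ∎
  where
  open ≤-Reasoning
  m = length 𝒱
  memberBound : ∀ v → 2 * separatedPairs (member 𝒱 v) ≤ d * d
  memberBound v with All.lookup members (∈-lookup v)
  ... | sign , support≡d = separatedPairs-bound (member 𝒱 v) sign support≡d
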